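{- Let $m \geq 2$ and $n, k \geq 1$ be integers. The number of compositions of $n$ with exactly $k$ parts, all parts at most $m$ and last part less than $m$, equals the number of compositions of $n$ with exactly $n-k+1$ parts which contain no run of $m-1$ or more consecutive parts equal to $1$, where the last part is excluded from consideration (i.e. no $m-1$ consecutive parts equal to $1$ occur among the parts other than the last part).
   Context: A composition of $n$ is a finite sequence of positive integers (its parts) summing to $n$, with order mattering. -}

module Defs where

open import Data.Nat using (ℕ; zero; suc; _+_; _∸_; _≤ᵇ_; _<ᵇ_; _≡ᵇ_)
open import Data.Bool using (Bool; true; false; _∧_; not)
open import Data.List using (List; []; _∷_; map; concatMap; filter; length; upTo)
open import Relation.Nullary.Decidable using (Dec)
open import Relation.Binary.PropositionalEquality using (_≡_)
open import Data.Bool using (T)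
open import Relation.Nullary.Decidable using (yes; no)

-- Well-founded via a fuel argument (fuel ≥ n).
compositionsFuel : ℕ → ℕ → List (List ℕ)
compositionsFuel fuel zero = [] ∷ []
compositionsFuel zero (suc n) = []
compositionsFuel (suc fuel) (suc n) =
  concatMap (λ i → map (suc i ∷_) (compositionsFuel fuel (n ∸ i))) (upTo (suc n))

compositions : ℕ → List (List ℕ)
compositions n = compositionsFuel n n

allAtMost : ℕ → List ℕ → Bool
allAtMost m [] = true
allAtMost m (x ∷ xs) = (x ≤ᵇ m) ∧ allAtMost m xs

-- last part of a nonempty list (0 for the empty list; never used there)
lastPart : List ℕ → ℕ
lastPart [] = 0
lastPart (x ∷ []) = x
lastPart (x ∷ y ∷ ys) = lastPart (y ∷ ys)

initParts : List ℕ → List ℕ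
initParts [] = []
initParts (x ∷ []) = []
initParts (x ∷ y ∷ ys) = x ∷ initParts (y ∷ ys)

hasRunOfOnesAux : ℕ → ℕ → List ℕ → Bool
hasRunOfOnesAux r c [] = r ≤ᵇ c
hasRunOfOnesAux r c (x ∷ xs) with r ≤ᵇ c
... | true = true
... | false with x ≡ᵇ 1
...   | true = hasRunOfOnesAux r (suc c) xs
...   | false = hasRunOfOnesAux r 0 xs

hasRunOfOnes : ℕ → List ℕ → Bool
hasRunOfOnes r xs = hasRunOfOnesAux r 0 xs

leftPred : ℕ → ℕ → List ℕ → Bool
leftPred m k c = (length c ≡ᵇ k) ∧ allAtMost m c ∧ (lastPart c <ᵇ m)

rightPred : ℕ → ℕ → List ℕ → Bool
rightPred m j c = (length c ≡ᵇ j) ∧ not (hasRunOfOnes (m ∸ 1) (initParts c))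

countLeft : ℕ → ℕ → ℕ → ℕ
countLeft m n k = length (Data.List.filter (λ c → T? (leftPred m k c)) (compositions n))
  where
  T? : (b : Bool) → Dec (T b)
  T? true = yes _
  T? false = no (λ ())

countRight : ℕ → ℕ → ℕ → ℕ
countRight m n k = length (Data.List.filter (λ c → T? (rightPred m (suc n ∸ k) c)) (compositions n))
  where
  T? : (b : Bool) → Dec (T b)
  T? true = yes _
  T? false = no (λ ())

-- A composition of n + 1 is encoded by a binary word of length n: true starts a new part and
-- false enlarges the current part by one.  On words, "all parts ≤ m and the first part < m" says
-- that every block of falses is shorter than m, the leading one shorter than m - 1.  Complementing
-- the word gives the conjugate composition, with n - k + 1 parts when the original has k; a block
-- of L falses becomes L - 1 consecutive parts equal to 1 before the last part (L of them for the
-- leading block), so the same condition says that no m - 1 consecutive parts other than the last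
-- equal 1.  Reversing the word exchanges first and last part, hence reversal followed by
-- complementation matches the two families.
module Submission where

open import Defs
open import Data.Nat using (ℕ; _≤_; _+_)
open import Relation.Binary.PropositionalEquality using (_≡_)

open import Data.Nat using (zero; suc; _∸_; _≤ᵇ_; _<ᵇ_; _≡ᵇ_; _≟_; _≤?_; _<?_; s≤s)
open import Data.Nat.Properties
  using (+-suc; +-identityʳ; +-comm; m+n∸m≡n; m∸n≤m; ≤-trans; n≤1+n; m≤m+n; m≤n⇒m≤1+n;
         ∸-cancelˡ-≡; m∸n≢0⇒n<m; 1+n≢0; <⇒≤; ≰⇒>; <⇒≱; +-commutativeSemigroup)
open import Algebra.Properties.CommutativeSemigroup +-commutativeSemigroup using (interchange)
open import Data.Bool using (Bool; true; false; _∧_; not; T; if_then_else_)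
open import Data.Bool.Properties using (∧-identityʳ; ∧-assoc; ∧-comm)
open import Data.List
  using (List; []; _∷_; [_]; _++_; _∷ʳ_; _ʳ++_; map; concatMap; filter; length; reverse;
         replicate; upTo; applyUpTo)
open import Data.List.Properties
  using (map-∘; map-concatMap; concatMap-map; concatMap-cong; map-upTo; ʳ++-defn;
         unfold-reverse; reverse-++; length-reverse)
open import Data.Product using (_,_)
open import Function using (_∘_; id)
open import Function.Bundles using (mk⇔)
open import Relation.Nullary.Decidable using (Dec; does; does-≡; does-⇔; T?; ¬?; _×-dec_)
open import Relation.Binary.PropositionalEquality using (refl; sym; trans; cong; cong₂; module ≡-Reasoning)
open ≡-Reasoning

private
  variable
    A B : Set

count : (A → Bool) → List A → ℕ
count P []       = 0
count P (x ∷ xs) = if P x then suc (count P xs) else count P xs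

length-filter : (P : A → Bool) (P? : ∀ x → Dec (T (P x))) (xs : List A) →
                length (filter P? xs) ≡ count P xs
length-filter P P? []       = refl
length-filter P P? (x ∷ xs) with does (P? x) | does-≡ (P? x) (T? (P x))
... | true  | P?x≡Px rewrite sym P?x≡Px = cong suc (length-filter P P? xs)
... | false | P?x≡Px rewrite sym P?x≡Px = length-filter P P? xs

count-++ : (P : A → Bool) (xs ys : List A) → count P (xs ++ ys) ≡ count P xs + count P ys
count-++ P []       ys = refl
count-++ P (x ∷ xs) ys with P x
... | true  = cong suc (count-++ P xs ys)
... | false = count-++ P xs ys

count-map : (P : B → Bool) (f : A → B) (xs : List A) → count P (map f xs) ≡ count (P ∘ f) xs
count-map P f []       = refl
count-map P f (x ∷ xs) with P (f x)
... | true  = cong suc (count-map P f xs)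
... | false = count-map P f xs

count+count-not : (P : A → Bool) (xs : List A) → count P xs + count (not ∘ P) xs ≡ length xs
count+count-not P []       = refl
count+count-not P (x ∷ xs) with P x
... | true  = cong suc (count+count-not P xs)
... | false = trans (+-suc (count P xs) _) (cong suc (count+count-not P xs))

countWords : ℕ → (List Bool → Bool) → ℕ
countWords zero    P = if P [] then 1 else 0
countWords (suc n) P = countWords n (P ∘ (true ∷_)) + countWords n (P ∘ (false ∷_))

countWords-cong : ∀ n {P Q : List Bool → Bool} → (∀ w → length w ≡ n → P w ≡ Q w) →
                  countWords n P ≡ countWords n Q
countWords-cong zero    P≡Q = cong (λ b → if b then 1 else 0) (P≡Q [] refl)
countWords-cong (suc n) P≡Q =
  cong₂ _+_ (countWords-cong n (λ w |w|≡n → P≡Q (true ∷ w) (cong suc |w|≡n)))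
            (countWords-cong n (λ w |w|≡n → P≡Q (false ∷ w) (cong suc |w|≡n)))

countWords-∷ʳ : ∀ n P → countWords (suc n) P ≡
                countWords n (λ w → P (w ∷ʳ true)) + countWords n (λ w → P (w ∷ʳ false))
countWords-∷ʳ zero    P = refl
countWords-∷ʳ (suc n) P =
  trans (cong₂ _+_ (countWords-∷ʳ n (P ∘ (true ∷_))) (countWords-∷ʳ n (P ∘ (false ∷_))))
        (interchange (ends true true) (ends true false) (ends false true) (ends false false))
  where
  ends : Bool → Bool → ℕ
  ends x y = countWords n (λ w → P (x ∷ w ∷ʳ y))

countWords-reverse : ∀ n P → countWords n P ≡ countWords n (P ∘ reverse)
countWords-reverse zero    P = refl
countWords-reverse (suc n) P = begin
    countWords n (P ∘ (true ∷_)) + countWords n (P ∘ (false ∷_))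
  ≡⟨ cong₂ _+_ (countWords-reverse n _) (countWords-reverse n _) ⟩
    countWords n (λ w → P (true ∷ reverse w)) + countWords n (λ w → P (false ∷ reverse w))
  ≡⟨ cong₂ _+_ (countWords-cong n λ w _ → cong P (reverse-++ w [ true ]))
               (countWords-cong n λ w _ → cong P (reverse-++ w [ false ])) ⟨
    countWords n (λ w → P (reverse (w ∷ʳ true))) + countWords n (λ w → P (reverse (w ∷ʳ false)))
  ≡⟨ countWords-∷ʳ n (P ∘ reverse) ⟨
    countWords (suc n) (P ∘ reverse) ∎

countWords-map-not : ∀ n P → countWords n P ≡ countWords n (P ∘ map not)
countWords-map-not zero    P = refl
countWords-map-not (suc n) P =
  trans (+-comm (countWords n (P ∘ (true ∷_))) _)
        (cong₂ _+_ (countWords-map-not n _) (countWords-map-not n _))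

-- build h w is the composition encoded by the word w, with h added to its first part.
build : ℕ → List Bool → List ℕ
build h []          = suc h ∷ []
build h (true ∷ w)  = suc h ∷ build 0 w
build h (false ∷ w) = build (suc h) w

sucHead : List ℕ → List ℕ
sucHead []       = []
sucHead (x ∷ xs) = suc x ∷ xs

sucHead-build : ∀ h w → sucHead (build h w) ≡ build (suc h) w
sucHead-build h []          = refl
sucHead-build h (true ∷ w)  = refl
sucHead-build h (false ∷ w) = sucHead-build (suc h) w

length-build : ∀ h w → length (build h w) ≡ suc (count id w)
length-build h []          = refl
length-build h (true ∷ w)  = cong suc (length-build 0 w)
length-build h (false ∷ w) = length-build (suc h) w

build-++ : ∀ h v u → build h (v ++ true ∷ u) ≡ build h v ++ build 0 u
build-++ h []          u = refl
build-++ h (true ∷ v)  u = cong (suc h ∷_) (build-++ 0 v u)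
build-++ h (false ∷ v) u = build-++ (suc h) v u

build-replicate : ∀ a h → build h (replicate a false) ≡ build (h + a) []
build-replicate zero    h = cong (λ x → build x []) (sym (+-identityʳ h))
build-replicate (suc a) h = trans (build-replicate a (suc h)) (cong (λ x → build x []) (sym (+-suc h a)))

reverse-build : ∀ h w → reverse (build h w) ≡ build 0 (w ʳ++ replicate h false)
reverse-build h []          = sym (build-replicate h 0)
reverse-build h (true ∷ w)  = begin
    reverse (suc h ∷ build 0 w)                        ≡⟨ ʳ++-defn (build 0 w) ⟩
    reverse (build 0 w) ++ [ suc h ]                   ≡⟨ cong₂ _++_ (reverse-build 0 w) (sym (build-replicate h 0)) ⟩
    build 0 (reverse w) ++ build 0 (replicate h false) ≡⟨ build-++ 0 (reverse w) (replicate h false) ⟨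
    build 0 (reverse w ++ true ∷ replicate h false)    ≡⟨ cong (build 0) (ʳ++-defn w) ⟨
    build 0 (w ʳ++ true ∷ replicate h false)           ∎
reverse-build h (false ∷ w) = reverse-build (suc h) w

compositionsFuel-irrelevant : ∀ {f f′} n → n ≤ f → n ≤ f′ → compositionsFuel f n ≡ compositionsFuel f′ n
compositionsFuel-irrelevant zero    _         _          = refl
compositionsFuel-irrelevant (suc n) (s≤s n≤f) (s≤s n≤f′) = concatMap-cong
  (λ i → cong (map (suc i ∷_)) (compositionsFuel-irrelevant (n ∸ i)
            (≤-trans (m∸n≤m n i) n≤f) (≤-trans (m∸n≤m n i) n≤f′)))
  (upTo (suc n))

compositions-suc : ∀ n → compositions (suc (suc n)) ≡
                   map (1 ∷_) (compositions (suc n)) ++ map sucHead (compositions (suc n))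
compositions-suc n = cong (map (1 ∷_) (compositions (suc n)) ++_) (begin
    concatMap first (applyUpTo suc (suc n))       ≡⟨ cong (concatMap first) (map-upTo suc (suc n)) ⟨
    concatMap first (map suc (upTo (suc n)))      ≡⟨ concatMap-map first suc (upTo (suc n)) ⟩
    concatMap (first ∘ suc) (upTo (suc n))        ≡⟨ concatMap-cong first-suc (upTo (suc n)) ⟩
    concatMap (map sucHead ∘ first′) (upTo (suc n)) ≡⟨ map-concatMap sucHead first′ (upTo (suc n)) ⟨
    map sucHead (compositions (suc n))            ∎)
  where
  first first′ : ℕ → List (List ℕ)
  first  i = map (suc i ∷_) (compositionsFuel (suc n) (suc n ∸ i))
  first′ i = map (suc i ∷_) (compositionsFuel n (n ∸ i))

  first-suc : ∀ i → first (suc i) ≡ map sucHead (first′ i)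
  first-suc i = trans
    (cong (map (suc (suc i) ∷_))
      (compositionsFuel-irrelevant (n ∸ i) (≤-trans (m∸n≤m n i) (n≤1+n n)) (m∸n≤m n i)))
    (map-∘ (compositionsFuel n (n ∸ i)))

count-compositions : ∀ n (P : List ℕ → Bool) → count P (compositions (suc n)) ≡ countWords n (P ∘ build 0)
count-compositions zero    P = refl
count-compositions (suc n) P = begin
    count P (compositions (suc (suc n)))
  ≡⟨ cong (count P) (compositions-suc n) ⟩
    count P (map (1 ∷_) cs ++ map sucHead cs)
  ≡⟨ count-++ P (map (1 ∷_) cs) (map sucHead cs) ⟩
    count P (map (1 ∷_) cs) + count P (map sucHead cs)
  ≡⟨ cong₂ _+_ (count-map P (1 ∷_) cs) (count-map P sucHead cs) ⟩
    count (P ∘ (1 ∷_)) cs + count (P ∘ sucHead) cs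
  ≡⟨ cong₂ _+_ (count-compositions n _) (count-compositions n _) ⟩
    countWords n (P ∘ (1 ∷_) ∘ build 0) + countWords n (P ∘ sucHead ∘ build 0)
  ≡⟨ cong (countWords n (P ∘ (1 ∷_) ∘ build 0) +_)
          (countWords-cong n λ w _ → cong P (sucHead-build 0 w)) ⟩
    countWords (suc n) (P ∘ build 0) ∎
  where
  cs = compositions (suc n)

not-≤ᵇ : ∀ r c → not (r ≤ᵇ c) ≡ (c <ᵇ r)
not-≤ᵇ r c = does-⇔ (mk⇔ ≰⇒> <⇒≱) (¬? (r ≤? c)) (c <? r)

<ᵇ-∧-suc<ᵇ : ∀ a m → (a <ᵇ m) ∧ (suc a <ᵇ m) ≡ (suc a <ᵇ m)
<ᵇ-∧-suc<ᵇ a       zero    = refl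
<ᵇ-∧-suc<ᵇ zero    (suc m) = refl
<ᵇ-∧-suc<ᵇ (suc a) (suc m) = <ᵇ-∧-suc<ᵇ a m

≤ᵇ-∧-<ᵇ : ∀ y m b → ((y ≤ᵇ m) ∧ b) ∧ (y <ᵇ m) ≡ (y <ᵇ m) ∧ b
≤ᵇ-∧-<ᵇ y m b = does-⇔
  (mk⇔ (λ ((_ , tb) , y<m) → y<m , tb) (λ (y<m , tb) → (<⇒≤ y<m , tb) , y<m))
  ((y ≤? m ×-dec T? b) ×-dec y <? m) (y <? m ×-dec T? b)

≡ᵇ-complement : ∀ {s t n} k → s + t ≡ n → (suc s ≡ᵇ k) ≡ (suc t ≡ᵇ suc (suc n) ∸ k)
≡ᵇ-complement {s} {t} k refl = does-⇔ (mk⇔ (λ { refl → sym complement }) from) (suc s ≟ k) (suc t ≟ _)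
  where
  complement : suc (s + t) ∸ s ≡ suc t
  complement = trans (cong (_∸ s) (sym (+-suc s t))) (m+n∸m≡n s (suc t))

  from : suc t ≡ suc (suc (s + t)) ∸ k → suc s ≡ k
  from eq = ∸-cancelˡ-≡ (s≤s (m≤n⇒m≤1+n (m≤m+n s t)))
                        (<⇒≤ (m∸n≢0⇒n<m (1+n≢0 ∘ trans eq)))
                        (trans complement eq)

-- falseRunsBelow m a w: a plus the length of the leading block of falses of w, and the length of
-- every later block, are below m.
falseRunsBelow : ℕ → ℕ → List Bool → Bool
falseRunsBelow m a []      = a <ᵇ m
falseRunsBelow m a (b ∷ w) = (a <ᵇ m) ∧ falseRunsBelow m (if b then 0 else suc a) w

falseRunsBelow-suc : ∀ m a w → falseRunsBelow m (suc a) w ≡ (a <ᵇ m) ∧ falseRunsBelow m (suc a) w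
falseRunsBelow-suc m a []      = sym (<ᵇ-∧-suc<ᵇ a m)
falseRunsBelow-suc m a (b ∷ w) =
  trans (cong (_∧ rest) (sym (<ᵇ-∧-suc<ᵇ a m))) (∧-assoc (a <ᵇ m) (suc a <ᵇ m) rest)
  where
  rest = falseRunsBelow m (if b then 0 else suc (suc a)) w

allAtMost-build : ∀ m h w → allAtMost m (build h w) ≡ falseRunsBelow m h w
allAtMost-build m h []          = ∧-identityʳ (h <ᵇ m)
allAtMost-build m h (true ∷ w)  = cong ((h <ᵇ m) ∧_) (allAtMost-build m 0 w)
allAtMost-build m h (false ∷ w) = trans (allAtMost-build m (suc h) w) (falseRunsBelow-suc m h w)

allAtMost-++ : ∀ m xs ys → allAtMost m (xs ++ ys) ≡ allAtMost m xs ∧ allAtMost m ys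
allAtMost-++ m []       ys = refl
allAtMost-++ m (x ∷ xs) ys =
  trans (cong ((x ≤ᵇ m) ∧_) (allAtMost-++ m xs ys)) (sym (∧-assoc (x ≤ᵇ m) _ _))

allAtMost-reverse : ∀ m xs → allAtMost m (reverse xs) ≡ allAtMost m xs
allAtMost-reverse m []       = refl
allAtMost-reverse m (x ∷ xs) = begin
    allAtMost m (reverse (x ∷ xs))                ≡⟨ cong (allAtMost m) (unfold-reverse x xs) ⟩
    allAtMost m (reverse xs ++ [ x ])             ≡⟨ allAtMost-++ m (reverse xs) [ x ] ⟩
    allAtMost m (reverse xs) ∧ ((x ≤ᵇ m) ∧ true)  ≡⟨ cong₂ _∧_ (allAtMost-reverse m xs) (∧-identityʳ _) ⟩
    allAtMost m xs ∧ (x ≤ᵇ m)                     ≡⟨ ∧-comm (allAtMost m xs) (x ≤ᵇ m) ⟩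
    allAtMost m (x ∷ xs)                          ∎

lastPart-∷ʳ : ∀ xs (x : ℕ) → lastPart (xs ∷ʳ x) ≡ x
lastPart-∷ʳ []           x = refl
lastPart-∷ʳ (y ∷ [])     x = refl
lastPart-∷ʳ (y ∷ z ∷ zs) x = lastPart-∷ʳ (z ∷ zs) x

leftPred-reverse : ∀ r k c → leftPred (suc r) k (reverse c) ≡ (length c ≡ᵇ k) ∧ allAtMost (suc r) (sucHead c)
leftPred-reverse r k []       = refl
leftPred-reverse r k (y ∷ ys) = cong₂ (λ l b → (l ≡ᵇ k) ∧ b) (length-reverse (y ∷ ys)) (begin
    allAtMost m (reverse (y ∷ ys)) ∧ (lastPart (reverse (y ∷ ys)) <ᵇ m)
  ≡⟨ cong₂ _∧_ (allAtMost-reverse m (y ∷ ys))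
               (cong (_<ᵇ m) (trans (cong lastPart (unfold-reverse y ys)) (lastPart-∷ʳ (reverse ys) y))) ⟩
    ((y ≤ᵇ m) ∧ allAtMost m ys) ∧ (y <ᵇ m)
  ≡⟨ ≤ᵇ-∧-<ᵇ y m (allAtMost m ys) ⟩
    (y <ᵇ m) ∧ allAtMost m ys ∎)
  where
  m = suc r

leftPred-reverse-build : ∀ r k w →
  leftPred (suc r) k (reverse (build 0 w)) ≡ (suc (count id w) ≡ᵇ k) ∧ falseRunsBelow (suc r) 1 w
leftPred-reverse-build r k w = trans (leftPred-reverse r k (build 0 w))
  (cong₂ (λ l b → (l ≡ᵇ k) ∧ b) (length-build 0 w)
         (trans (cong (allAtMost (suc r)) (sucHead-build 0 w)) (allAtMost-build (suc r) 1 w)))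

hasRunOfOnesAux-∷ : ∀ r c x xs → not (hasRunOfOnesAux r c (x ∷ xs)) ≡
  (c <ᵇ r) ∧ not (hasRunOfOnesAux r (if x ≡ᵇ 1 then suc c else 0) xs)
hasRunOfOnesAux-∷ r c x xs rewrite sym (not-≤ᵇ r c) with r ≤ᵇ c
... | true  = refl
... | false with x ≡ᵇ 1
...   | true  = refl
...   | false = refl

initParts-build : ∀ x h w → initParts (x ∷ build h w) ≡ x ∷ initParts (build h w)
initParts-build x h []          = refl
initParts-build x h (true ∷ w)  = refl
initParts-build x h (false ∷ w) = initParts-build x (suc h) w

hasRunOfOnesAux-build : ∀ r c x h u → not (hasRunOfOnesAux r c (initParts (x ∷ build h u))) ≡
  (c <ᵇ r) ∧ not (hasRunOfOnesAux r (if x ≡ᵇ 1 then suc c else 0) (initParts (build h u)))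
hasRunOfOnesAux-build r c x h u rewrite initParts-build x h u = hasRunOfOnesAux-∷ r c x _

-- The run counter c of hasRunOfOnesAux corresponds to the offset 1 + c of falseRunsBelow; in the
-- second lemma the current part is already ≥ 2, so the next separator resets the counter.
noRunOfOnes-build : ∀ r c w → not (hasRunOfOnesAux r c (initParts (build 0 (map not w)))) ≡
  falseRunsBelow (suc r) (suc c) w
noRunOfOnes-build⁺ : ∀ r c h w → not (hasRunOfOnesAux r c (initParts (build (suc h) (map not w)))) ≡
  (c <ᵇ r) ∧ falseRunsBelow (suc r) 0 w

noRunOfOnes-build r c []          = not-≤ᵇ r c
noRunOfOnes-build r c (true ∷ w)  = noRunOfOnes-build⁺ r c 0 w
noRunOfOnes-build r c (false ∷ w) =
  trans (hasRunOfOnesAux-build r c 1 0 (map not w)) (cong ((c <ᵇ r) ∧_) (noRunOfOnes-build r (suc c) w))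

noRunOfOnes-build⁺ r c h []          = trans (not-≤ᵇ r c) (sym (∧-identityʳ (c <ᵇ r)))
noRunOfOnes-build⁺ r c h (true ∷ w)  = noRunOfOnes-build⁺ r c (suc h) w
noRunOfOnes-build⁺ r c h (false ∷ w) =
  trans (hasRunOfOnesAux-build r c (suc (suc h)) 0 (map not w)) (cong ((c <ᵇ r) ∧_) (noRunOfOnes-build r 0 w))

rightPred-build-map-not : ∀ r j w →
  rightPred (suc r) j (build 0 (map not w)) ≡ (suc (count not w) ≡ᵇ j) ∧ falseRunsBelow (suc r) 1 w
rightPred-build-map-not r j w = cong₂ (λ l b → (l ≡ᵇ j) ∧ b)
  (trans (length-build 0 (map not w)) (cong suc (count-map id not w)))
  (noRunOfOnes-build r 0 w)

leftPred-reverse≡rightPred-map-not : ∀ r n k w → length w ≡ n →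
  leftPred (suc r) k (build 0 (reverse w)) ≡ rightPred (suc r) (suc (suc n) ∸ k) (build 0 (map not w))
leftPred-reverse≡rightPred-map-not r n k w |w|≡n = begin
    leftPred (suc r) k (build 0 (reverse w))
  ≡⟨ cong (leftPred (suc r) k) (reverse-build 0 w) ⟨
    leftPred (suc r) k (reverse (build 0 w))
  ≡⟨ leftPred-reverse-build r k w ⟩
    (suc (count id w) ≡ᵇ k) ∧ falseRunsBelow (suc r) 1 w
  ≡⟨ cong (_∧ falseRunsBelow (suc r) 1 w) (≡ᵇ-complement k (trans (count+count-not id w) |w|≡n)) ⟩
    (suc (count not w) ≡ᵇ suc (suc n) ∸ k) ∧ falseRunsBelow (suc r) 1 w
  ≡⟨ rightPred-build-map-not r (suc (suc n) ∸ k) w ⟨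
    rightPred (suc r) (suc (suc n) ∸ k) (build 0 (map not w)) ∎

proposition2p3 : (m n k : ℕ) → 2 ≤ m → 1 ≤ n → 1 ≤ k →
    countLeft m n k ≡ countRight m n k
proposition2p3 _ _ k (s≤s {n = r} _) (s≤s {n = n} _) _ = begin
    countLeft m (suc n) k
  ≡⟨ length-filter (leftPred m k) _ (compositions (suc n)) ⟩
    count (leftPred m k) (compositions (suc n))
  ≡⟨ count-compositions n (leftPred m k) ⟩
    countWords n (leftPred m k ∘ build 0)
  ≡⟨ countWords-reverse n (leftPred m k ∘ build 0) ⟩
    countWords n (leftPred m k ∘ build 0 ∘ reverse)
  ≡⟨ countWords-cong n (leftPred-reverse≡rightPred-map-not r n k) ⟩
    countWords n (rightPred m j ∘ build 0 ∘ map not)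
  ≡⟨ countWords-map-not n (rightPred m j ∘ build 0) ⟨
    countWords n (rightPred m j ∘ build 0)
  ≡⟨ count-compositions n (rightPred m j) ⟨
    count (rightPred m j) (compositions (suc n))
  ≡⟨ length-filter (rightPred m j) _ (compositions (suc n)) ⟨
    countRight m (suc n) k ∎
  where
  m = suc r
  j = suc (suc n) ∸ k
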